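{- Let $n,k,\ell$ be integers with $0<k<n$ and $1<\ell$, let $x^0\in\mathbb{Z}^n$ with $x^0_1\le\dots\le x^0_n$, and let $(x^j)_{j\ge0}$ be the GM-$(n,k,\ell)$-sequence starting at $x^0$. Let $N=N(n,k,\ell,x^0)\ge0$ be the integer such that, for all $j\ge0$, both $m(x^j)\ge n-k$ and $\mathrm{range}(x^j)\le\ell$ hold if and only if $j\ge N$. Then for each $i\in[n]$ and each $j\ge N$: $i$ is a bear in $x^j$ if and only if $i+k \bmod n$ is a bear in $x^{j+\ell}$ (residues taken in $\{1,\dots,n\}$, so that $n\bmod n=n$).
   Context: Notation: $[n]=\{1,\dots,n\}$. For an integer vector $x=(x_1,\dots,x_n)$ with $x_1\le\dots\le x_n$, let $M(x)$ be the set of indices $i\in[n]$ such that $x_i$ is a multiple of $\ell$, $m(x)=|M(x)|$, and $\mathrm{range}(x)=x_n-x_1$. The set $P(x)$ of bears (always of size $n-k$) is defined as follows. If $m(x)\ge n-k$: order the indices in $M(x)$ by increasing value $x_i$, and among indices with equal values by decreasing index $i$ (tie-breaking rule: prefer the rightmost), and let $P(x)$ be the first $n-k$ of them. If $m(x)<n-k$: $P(x)$ consists of all of $M(x)$ together with the $n-k-m(x)$ indices of $[n]\setminus M(x)$ with largest index. The remaining $k$ indices are bulls. The GM-$(n,k,\ell)$-move $x\to x'$ is given by $x'_i=x_i$ for $i\in P(x)$ and $x'_i=x_i-1$ for bulls; it preserves the nondecreasing order of entries. The GM-$(n,k,\ell)$-sequence from $x^0$ is $x^0\to x^1\to\cdots$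 with $x^{j+1}$ the GM-move of $x^j$. -}

module Defs where

open import Data.Nat as ℕ using (ℕ; zero; suc; _∸_)
open import Data.Nat.Divisibility using (_∣?_)
open import Data.Integer as ℤ using (ℤ; +_; _-_; ∣_∣)
open import Data.Fin using (Fin; zero; suc; fromℕ; toℕ)
open import Data.Bool using (Bool; true; false; if_then_else_; _∧_; _∨_; not)
open import Relation.Nullary.Decidable using (does)

-- Vectors in ℤ^n are functions Fin n → ℤ; index i : Fin n stands for the
-- paper's index toℕ i + 1 ∈ [n].

count : ∀ {n} → (Fin n → Bool) → ℕ
count {zero}  p = 0
count {suc n} p = (if p zero then 1 else 0) ℕ.+ count (λ i → p (suc i))

inM : (ℓ : ℕ) → ℤ → Bool
inM ℓ z = does (ℓ ∣? ∣ z ∣)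

m : ∀ {n} → ℕ → (Fin n → ℤ) → ℕ
m ℓ x = count (λ i → inM ℓ (x i))

-- range(x) = x_n - x_1  (0 for the empty vector, never used)
range : ∀ {n} → (Fin n → ℤ) → ℤ
range {zero}  x = + 0
range {suc n} x = x (fromℕ n) - x zero

precedes : ∀ {n} → (Fin n → ℤ) → Fin n → Fin n → Bool
precedes x j i = does (x j ℤ.<? x i) ∨ (does (x j ℤ.≟ x i) ∧ does (toℕ i ℕ.<? toℕ j))

isBear : ∀ {n} → (k ℓ : ℕ) → (Fin n → ℤ) → Fin n → Bool
isBear {n} k ℓ x i with does ((n ∸ k) ℕ.≤? m ℓ x)
... | true  = -- P(x) = first n-k elements of M(x) in the order above
  inM ℓ (x i) ∧ does (count (λ j → inM ℓ (x j) ∧ precedes x j i) ℕ.<? (n ∸ k))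
... | false = -- P(x) = M(x) ∪ {the n-k-m(x) largest indices outside M(x)}
  inM ℓ (x i) ∨
  does (count (λ j → not (inM ℓ (x j)) ∧ does (toℕ i ℕ.<? toℕ j)) ℕ.<? ((n ∸ k) ∸ m ℓ x))

gmMove : ∀ {n} → (k ℓ : ℕ) → (Fin n → ℤ) → (Fin n → ℤ)
gmMove k ℓ x i = if isBear k ℓ x i then x i else x i - + 1

gmSeq : ∀ {n} → (k ℓ : ℕ) → (Fin n → ℤ) → ℕ → (Fin n → ℤ)
gmSeq k ℓ x0 zero    = x0
gmSeq k ℓ x0 (suc j) = gmMove k ℓ (gmSeq k ℓ x0 j)

-- the index "i + k mod n" (residues in {1..n}) in 0-based form: (i0 + k) mod n
shiftIdx : ∀ {n} → (k : ℕ) → Fin n → Fin n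
shiftIdx {zero}  k ()
shiftIdx {suc n} k i = Data.Fin.fromℕ< (Data.Nat.DivMod.m%n<n (toℕ i ℕ.+ k) (suc n))
  where import Data.Nat.DivMod

module Submission where

-- In the stable regime the ranking that selects the bears becomes a local rule: i is a bear iff
-- x_i is a multiple of ℓ and its predecessor x_{i-k}, lowered by ℓ when i - k wraps around, lies
-- strictly above x_i - ℓ.  Under the local rule every coordinate goes through the same period of
-- ℓ steps: it falls to the multiple of ℓ just below it, rests there while its predecessor is close
-- enough, and then falls to the (lowered) value its predecessor had at the start.  So ℓ steps move
-- each value k places to the right, and since i is a bear exactly when x_i does not move, so do
-- the bears.

open import Data.Nat as ℕ using (ℕ; zero; suc; _∸_; z≤n; s≤s; NonZero)
import Data.Nat.Properties as ℕ
open import Algebra.Properties.CommutativeSemigroup ℕ.+-commutativeSemigroup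
  using () renaming (xy∙z≈xz∙y to +-right-comm)
open import Data.Fin as Fin using (Fin; zero; suc; toℕ)
import Data.Fin.Properties as Fin
open import Data.Integer as ℤ using (ℤ; +_; -[1+_]; _+_; _-_; _*_; _≤_; _<_; +≤+; +<+; ∣_∣)
open import Data.Integer.Properties as ℤ
  using (+-monoˡ-≤; +-monoʳ-≤; +-monoˡ-<; +-monoʳ-<; +-identityʳ; +-injective;
         ≤-trans; <-≤-trans; ≤-<-trans; <-irrefl; *-cancelʳ-<-nonNeg)
open import Data.Nat.DivMod using (_%_; m<n⇒m%n≡m; [m+n]%n≡m%n)
open import Data.Integer.DivMod using (_/ℕ_; _%ℕ_; a≡a%ℕn+[a/ℕn]*n; n%ℕd<d)
open import Data.Integer.Divisibility.Signed using (_∣_; divides; ∣-refl; ∣m∣n⇒∣m-n; ∣ᵤ⇒∣; ∣⇒∣ᵤ)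
import Data.Nat.Divisibility as ℕ
open import Data.Integer.Tactic.RingSolver using (solve-∀; solve)
open import Data.List using (_∷_; [])
open import Data.Bool using (Bool; true; false; T; not; _∧_; _∨_; if_then_else_)
open import Data.Bool.Properties using (T-∧; T-∨; T-not-≡; ∧-zeroʳ)
open import Data.Product using (Σ; _×_; _,_; proj₁; proj₂)
open import Data.Sum using (_⊎_; inj₁; inj₂)
open import Data.Empty using (⊥; ⊥-elim)
open import Function using (id; _∘_; Equivalence; _⇔_; mk⇔)
import Function.Properties.Equivalence as ⇔
open import Relation.Nullary using (¬_)
open import Relation.Nullary.Decidable using (Dec; yes; no; does; dec-true; dec-false)
open import Relation.Binary.PropositionalEquality
open import Relation.Binary.Definitions using (tri<; tri≈; tri>)
open import Defs

fromDoes : ∀ {a} {A : Set a} (d : Dec A) → T (does d) → A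
fromDoes (yes a) _ = a

toDoes : ∀ {a} {A : Set a} (d : Dec A) → A → T (does d)
toDoes d a = subst T (sym (dec-true d a)) _

∧-cong-T : ∀ a {b c} → (T a → b ≡ c) → a ∧ b ≡ a ∧ c
∧-cong-T true  b≡c = b≡c _
∧-cong-T false _   = refl

T-∧-map : ∀ {a a′ b b′} → (T a → T a′) → (T b → T b′) → T (a ∧ b) → T (a′ ∧ b′)
T-∧-map {true}  {a′} {true}  f g _  = Equivalence.from (T-∧ {a′}) (f _ , g _)
T-∧-map {true} {b = false}  f g ()
T-∧-map {false}              f g ()

T-∨-map : ∀ {a a′ b b′} → (T a → T a′) → (T b → T b′) → T (a ∨ b) → T (a′ ∨ b′)
T-∨-map {true}                f g _  = Equivalence.from T-∨ (inj₁ (f _))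
T-∨-map {false} {a′} {true}   f g _  = Equivalence.from (T-∨ {a′}) (inj₂ (g _))
T-∨-map {false} {b = false} f g ()

count-false : ∀ n → count {n} (λ _ → false) ≡ 0
count-false zero    = refl
count-false (suc n) = count-false n

count-mono : ∀ {n} {p q : Fin n → Bool} → (∀ j → T (p j) → T (q j)) → count p ℕ.≤ count q
count-mono {zero}  p⊆q = z≤n
count-mono {suc n} {p} {q} p⊆q with p zero in p₀ | q zero in q₀
... | true  | true  = s≤s (count-mono (p⊆q ∘ suc))
... | true  | false = ⊥-elim (subst T q₀ (p⊆q zero (subst T (sym p₀) _)))
... | false | true  = ℕ.m≤n⇒m≤1+n (count-mono (p⊆q ∘ suc))
... | false | false = count-mono (p⊆q ∘ suc)

count<-antimono : ∀ {n} {p q : Fin n → Bool} c → (∀ j → T (p j) → T (q j)) →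
                  T (does (count q ℕ.<? c)) → T (does (count p ℕ.<? c))
count<-antimono {p = p} {q} c p⊆q q<c =
  toDoes (count p ℕ.<? c) (ℕ.≤-<-trans (count-mono p⊆q) (fromDoes (count q ℕ.<? c) q<c))

count-complement : ∀ {n} (p : Fin n → Bool) → count p ℕ.+ count (not ∘ p) ≡ n
count-complement {zero}  p = refl
count-complement {suc n} p with p zero
... | true  = cong suc (count-complement (p ∘ suc))
... | false = trans (ℕ.+-suc (count (p ∘ suc)) _) (cong suc (count-complement (p ∘ suc)))

count-not : ∀ {n} (p : Fin n → Bool) → count (not ∘ p) ≡ n ∸ count p
count-not {n} p = sym (trans (cong (_∸ count p) (sym (count-complement p))) (ℕ.m+n∸m≡n (count p) _))

count-below : ∀ {n} h → h ℕ.≤ n → count {n} (λ j → does (toℕ j ℕ.<? h)) ≡ h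
count-below {zero}  zero    _         = refl
count-below {suc n} zero    _         = count-false n
count-below {suc n} (suc h) (s≤s h≤n) = cong suc (count-below h h≤n)

-- lo ≤ j is tested as lo < suc j, which makes shifting both bounds by one definitional.
inInterval : ∀ {n} → ℕ → ℕ → Fin n → Bool
inInterval lo hi j = does (lo ℕ.<? suc (toℕ j)) ∧ does (toℕ j ℕ.<? hi)

count-inInterval : ∀ {n} lo hi → lo ℕ.≤ hi → hi ℕ.≤ n → count {n} (inInterval lo hi) ≡ hi ∸ lo
count-inInterval zero hi _ hi≤n = count-below hi hi≤n
count-inInterval {suc n} (suc lo) (suc hi) (s≤s lo≤hi) (s≤s hi≤n) = count-inInterval lo hi lo≤hi hi≤n

inInterval⁻ : ∀ {n} {lo hi} (j : Fin n) → T (inInterval lo hi j) → lo ℕ.≤ toℕ j × toℕ j ℕ.< hi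
inInterval⁻ {lo = lo} {hi} j t with Equivalence.to (T-∧ {does (lo ℕ.<? suc (toℕ j))}) t
... | lo≤j , j<hi = ℕ.≤-pred (fromDoes (lo ℕ.<? suc (toℕ j)) lo≤j) , fromDoes (toℕ j ℕ.<? hi) j<hi

inInterval⁺ : ∀ {n} {lo hi} (j : Fin n) → lo ℕ.≤ toℕ j → toℕ j ℕ.< hi → T (inInterval lo hi j)
inInterval⁺ {lo = lo} {hi} j lo≤j j<hi =
  Equivalence.from T-∧ (toDoes (lo ℕ.<? suc (toℕ j)) (s≤s lo≤j) , toDoes (toℕ j ℕ.<? hi) j<hi)

module _ {n} (p : Fin n → Bool) {lo hi} (lo≤hi : lo ℕ.≤ hi) (hi≤n : hi ℕ.≤ n) where

  count-outside : count (not ∘ inInterval {n} lo hi) ≡ n ∸ (hi ∸ lo)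
  count-outside =
    trans (count-not (inInterval {n} lo hi)) (cong (n ∸_) (count-inInterval lo hi lo≤hi hi≤n))

  count-≤-inside : (∀ j → T (p j) → lo ℕ.≤ toℕ j × toℕ j ℕ.< hi) → count p ℕ.≤ hi ∸ lo
  count-≤-inside p⊆ = subst (count p ℕ.≤_) (count-inInterval lo hi lo≤hi hi≤n)
    (count-mono λ j pj → let (lo≤j , j<hi) = p⊆ j pj in inInterval⁺ j lo≤j j<hi)

  count-≥-inside : (∀ j → lo ℕ.≤ toℕ j → toℕ j ℕ.< hi → T (p j)) → hi ∸ lo ℕ.≤ count p
  count-≥-inside ⊆p = subst (ℕ._≤ count p) (count-inInterval lo hi lo≤hi hi≤n)
    (count-mono λ j j∈ → let (lo≤j , j<hi) = inInterval⁻ j j∈ in ⊆p j lo≤j j<hi)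

  count-≤-outside : (∀ j → T (p j) → lo ℕ.≤ toℕ j → toℕ j ℕ.< hi → ⊥) → count p ℕ.≤ n ∸ (hi ∸ lo)
  count-≤-outside p∩ = subst (count p ℕ.≤_) count-outside (count-mono outside)
    where
    outside : ∀ j → T (p j) → T (not (inInterval {n} lo hi j))
    outside j pj with inInterval lo hi j in j∈
    ... | false = _
    ... | true  = let (lo≤j , j<hi) = inInterval⁻ j (subst T (sym j∈) _) in p∩ j pj lo≤j j<hi

  count-≥-outside : (∀ j → toℕ j ℕ.< lo ⊎ hi ℕ.≤ toℕ j → T (p j)) → n ∸ (hi ∸ lo) ℕ.≤ count p
  count-≥-outside ⊆p = subst (ℕ._≤ count p) count-outside (count-mono inside)
    where
    inside : ∀ j → T (not (inInterval {n} lo hi j)) → T (p j)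
    inside j j∉ with toℕ j ℕ.<? lo | hi ℕ.≤? toℕ j
    ... | yes j<lo | _        = ⊆p j (inj₁ j<lo)
    ... | no _     | yes hi≤j = ⊆p j (inj₂ hi≤j)
    ... | no j≮lo  | no hi≰j  =
      ⊥-elim (subst T (Equivalence.to T-not-≡ j∉) (inInterval⁺ j (ℕ.≮⇒≥ j≮lo) (ℕ.≰⇒> hi≰j)))

module _ {n k} (k<n : k ℕ.< n) (p : Fin n → Bool) {a b : ℕ} where

  few-outside-window : a ℕ.+ k ≡ b → b ℕ.< n → (∀ j → T (p j) → a ℕ.≤ toℕ j → toℕ j ℕ.≤ b → ⊥) →
                       count p ℕ.< n ∸ k
  few-outside-window refl b<n p∩ = ℕ.≤-<-trans
    (subst (λ w → count p ℕ.≤ n ∸ w) width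
      (count-≤-outside p (ℕ.m≤n⇒m≤1+n (ℕ.m≤m+n a k)) b<n
         λ j pj a≤j j<b+1 → p∩ j pj a≤j (ℕ.≤-pred j<b+1)))
    (ℕ.∸-monoʳ-< (ℕ.n<1+n k) k<n)
    where
    width : suc (a ℕ.+ k) ∸ a ≡ suc k
    width = trans (cong (_∸ a) (sym (ℕ.+-suc a k))) (ℕ.m+n∸m≡n a (suc k))

  many-outside-window : a ℕ.+ k ≡ b → b ℕ.< n → (∀ j → toℕ j ℕ.≤ a ⊎ b ℕ.< toℕ j → T (p j)) →
                        n ∸ k ℕ.≤ count p
  many-outside-window refl b<n ⊆p =
    subst (λ w → n ∸ w ℕ.≤ count p) (ℕ.m+n∸m≡n a k)
      (count-≥-outside p (s≤s (ℕ.m≤m+n a k)) b<n λ where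
        j (inj₁ j<a+1) → ⊆p j (inj₁ (ℕ.≤-pred j<a+1))
        j (inj₂ b<j)   → ⊆p j (inj₂ b<j))

  few-inside-window : b ℕ.+ (n ∸ k) ≡ a → a ℕ.< n → (∀ j → T (p j) → b ℕ.< toℕ j × toℕ j ℕ.< a) →
                      count p ℕ.< n ∸ k
  few-inside-window refl a<n p⊆ = ℕ.≤-<-trans
    (subst (count p ℕ.≤_) width (count-≤-inside p b<a (ℕ.<⇒≤ a<n) p⊆))
    (ℕ.∸-monoʳ-< (s≤s z≤n) 0<n∸k)
    where
    0<n∸k : 0 ℕ.< n ∸ k
    0<n∸k = ℕ.m<n⇒0<n∸m k<n
    b<a : b ℕ.< b ℕ.+ (n ∸ k)
    b<a = subst (ℕ._≤ b ℕ.+ (n ∸ k)) (ℕ.+-comm b 1) (ℕ.+-monoʳ-≤ b 0<n∸k)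
    width : b ℕ.+ (n ∸ k) ∸ suc b ≡ n ∸ k ∸ 1
    width = trans (cong (b ℕ.+ (n ∸ k) ∸_) (ℕ.+-comm 1 b)) (ℕ.[m+n]∸[m+o]≡n∸o b (n ∸ k) 1)

  many-inside-window : b ℕ.+ (n ∸ k) ≡ a → a ℕ.< n → (∀ j → b ℕ.< toℕ j → toℕ j ℕ.≤ a → T (p j)) →
                       n ∸ k ℕ.≤ count p
  many-inside-window refl a<n ⊆p =
    subst (ℕ._≤ count p) (ℕ.m+n∸m≡n b (n ∸ k))
      (count-≥-inside p (s≤s (ℕ.m≤m+n b _)) a<n λ j b<j j≤a → ⊆p j b<j (ℕ.≤-pred j≤a))

≤-translate : ∀ {a b a' b'} c → a + c ≡ a' → b + c ≡ b' → a ≤ b → a' ≤ b'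
≤-translate c refl refl = +-monoˡ-≤ c

<-translate : ∀ {a b a' b'} c → a + c ≡ a' → b + c ≡ b' → a < b → a' < b'
<-translate c refl refl = +-monoˡ-< c

≤+⇒-≤ : ∀ {a b} c → a ≤ b + c → a - c ≤ b
≤+⇒-≤ {a} {b} c = ≤-translate (ℤ.- c) refl (solve (b ∷ c ∷ []))

≤-⇒+≤ : ∀ {a b} c → a ≤ b - c → a + c ≤ b
≤-⇒+≤ {a} {b} c = ≤-translate c refl (solve (b ∷ c ∷ []))

-‿cancelʳ-≤ : ∀ {a b} c → a - c ≤ b - c → a ≤ b
-‿cancelʳ-≤ {a} {b} c = ≤-translate c (solve (a ∷ c ∷ [])) (solve (b ∷ c ∷ []))

-‿cancelʳ-< : ∀ {a b} c → a - c < b - c → a < b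
-‿cancelʳ-< {a} {b} c = <-translate c (solve (a ∷ c ∷ [])) (solve (b ∷ c ∷ []))

≤-witness : ∀ {a b} → a ≤ b → Σ ℕ λ d → b ≡ a + + d
≤-witness {a} {b} a≤b = ∣ b - a ∣ , (begin
  b                ≡⟨ solve (a ∷ b ∷ []) ⟩
  a + (b - a)      ≡⟨ cong (λ d → a + d) (sym (ℤ.0≤i⇒+∣i∣≡i (ℤ.i≤j⇒0≤j-i a≤b))) ⟩
  a + + ∣ b - a ∣  ∎)
  where open ≡-Reasoning

-+-cancel : ∀ a c → a - c + c ≡ a
-+-cancel = solve-∀

-‿cong⇔ : ∀ {a b} c → (a ≡ b) ⇔ (a - c ≡ b - c)
-‿cong⇔ {a} {b} c =
  mk⇔ (cong (_- c)) λ eq → trans (sym (-+-cancel a c)) (trans (cong (_+ c) eq) (-+-cancel b c))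

<⇒≤-1 : ∀ {a b} → a < b → a ≤ b - + 1
<⇒≤-1 {a} {b} a<b = subst (a ≤_) (ℤ.+-comm (ℤ.- + 1) b) (ℤ.i<j⇒i≤pred[j] a<b)

i-pos<i : ∀ a {d} → 0 ℕ.< d → a - + d < a
i-pos<i a {d} 0<d = <-translate (a - + d) (lhs a (+ d)) (rhs a (+ d)) (+<+ 0<d)
  where
  lhs : ∀ a c → + 0 + (a - c) ≡ a - c
  lhs = solve-∀
  rhs : ∀ a c → c + (a - c) ≡ a
  rhs = solve-∀

i<i+pos : ∀ a {d} → 0 ℕ.< d → a < a + + d
i<i+pos a 0<d = subst (_< a + _) (+-identityʳ a) (+-monoʳ-< a (+<+ 0<d))

no-multiple-above : ∀ {ℓ a u} → + ℓ ∣ a → + ℓ ∣ u → a < u → u < a + + ℓ → ⊥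
no-multiple-above {ℓ} (divides q refl) (divides r refl) a<u u<a+ℓ =
  <-irrefl refl (≤-<-trans (ℤ.i<j⇒suc[i]≤j q<r) r<q+1)
  where
  q<r : q < r
  q<r = *-cancelʳ-<-nonNeg (+ ℓ) a<u
  next-multiple : ∀ q l → q * l + l ≡ (+ 1 + q) * l
  next-multiple = solve-∀
  r<q+1 : r < + 1 + q
  r<q+1 = *-cancelʳ-<-nonNeg (+ ℓ) (subst (r * + ℓ <_) (next-multiple q (+ ℓ)) u<a+ℓ)

no-multiple-below : ∀ {ℓ a u} → + ℓ ∣ a → + ℓ ∣ u → a - + ℓ < u → u < a → ⊥
no-multiple-below {ℓ} {a} ℓ∣a ℓ∣u a-ℓ<u u<a =
  no-multiple-above (∣m∣n⇒∣m-n ℓ∣a ∣-refl) ℓ∣u a-ℓ<u (subst (_ <_) (sym (-+-cancel a (+ ℓ))) u<a)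

roundDown : (ℓ : ℕ) .{{_ : NonZero ℓ}} → ℤ → ℤ
roundDown ℓ x = (x /ℕ ℓ) * + ℓ

module _ (ℓ : ℕ) .{{_ : NonZero ℓ}} (x : ℤ) where

  roundDown-multiple : + ℓ ∣ roundDown ℓ x
  roundDown-multiple = divides (x /ℕ ℓ) refl

  roundDown+residue : x ≡ + (x %ℕ ℓ) + roundDown ℓ x
  roundDown+residue = a≡a%ℕn+[a/ℕn]*n x ℓ

  residue<ℓ : x %ℕ ℓ ℕ.< ℓ
  residue<ℓ = n%ℕd<d x ℓ

  <-roundDown+ℓ : x < roundDown ℓ x + + ℓ
  <-roundDown+ℓ = subst (_< roundDown ℓ x + + ℓ)
                        (trans (ℤ.+-comm (roundDown ℓ x) _) (sym roundDown+residue))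
                        (+-monoʳ-< (roundDown ℓ x) (+<+ residue<ℓ))

inM-sound : ∀ {ℓ} z → T (inM ℓ z) → + ℓ ∣ z
inM-sound {ℓ} z t = ∣ᵤ⇒∣ (fromDoes (ℓ ℕ.∣? ∣ z ∣) t)

inM-true : ∀ {ℓ z} → + ℓ ∣ z → inM ℓ z ≡ true
inM-true {ℓ} {z} ℓ∣z = dec-true (ℓ ℕ.∣? ∣ z ∣) (∣⇒∣ᵤ ℓ∣z)

inM-false : ∀ {ℓ z} → ¬ + ℓ ∣ z → inM ℓ z ≡ false
inM-false {ℓ} {z} ℓ∤z = dec-false (ℓ ℕ.∣? ∣ z ∣) (ℓ∤z ∘ ∣ᵤ⇒∣)

-- The local rule and the orbit of a single coordinate

stays : ℕ → ℤ → ℤ → Bool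
stays ℓ u v = inM ℓ u ∧ does (u - + ℓ ℤ.<? v)

localMove : ℕ → ℤ → ℤ → ℤ
localMove ℓ u v = if stays ℓ u v then u else u - + 1

localMove-stays : ∀ {ℓ u v} → + ℓ ∣ u → u - + ℓ < v → localMove ℓ u v ≡ u
localMove-stays {ℓ} {u} {v} ℓ∣u u-ℓ<v rewrite inM-true ℓ∣u | dec-true (u - + ℓ ℤ.<? v) u-ℓ<v = refl

localMove-falls : ∀ {ℓ u v} → ¬ + ℓ ∣ u ⊎ v ≤ u - + ℓ → localMove ℓ u v ≡ u - + 1
localMove-falls {ℓ} {u} {v} (inj₁ ℓ∤u) rewrite inM-false {ℓ} ℓ∤u = refl
localMove-falls {ℓ} {u} {v} (inj₂ v≤u-ℓ)
  rewrite dec-false (u - + ℓ ℤ.<? v) (ℤ.≤⇒≯ v≤u-ℓ) | ∧-zeroʳ (inM ℓ u) = refl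

-- Started at A + α, the coordinate falls by one per step down to A, rests at A until time τ,
-- and falls again afterwards.
orbit : ℤ → ℕ → ℕ → ℕ → ℤ
orbit A α τ s = A + + (α ∸ s) - + (s ∸ τ)

orbit-start : ∀ A α τ → orbit A α τ 0 ≡ + α + A
orbit-start A α τ rewrite ℕ.0∸n≡0 τ = regroup A (+ α)
  where regroup : ∀ A a → A + a - + 0 ≡ a + A
        regroup = solve-∀

orbit-descending : ∀ A α {τ s} → s ℕ.≤ τ → orbit A α τ s ≡ A + + (α ∸ s)
orbit-descending A α {τ} {s} s≤τ rewrite ℕ.m≤n⇒m∸n≡0 s≤τ = +-identityʳ _

orbit-ascending : ∀ A {α τ s} → α ℕ.≤ τ → τ ℕ.≤ s → orbit A α τ s ≡ A - + (s ∸ τ)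
orbit-ascending A {α} {τ} {s} α≤τ τ≤s rewrite ℕ.m≤n⇒m∸n≡0 (ℕ.≤-trans α≤τ τ≤s) =
  cong (_- _) (+-identityʳ A)

orbit-at-rest : ∀ A {α τ s} → α ℕ.≤ s → s ℕ.≤ τ → orbit A α τ s ≡ A
orbit-at-rest A {α} {τ} {s} α≤s s≤τ rewrite ℕ.m≤n⇒m∸n≡0 α≤s | ℕ.m≤n⇒m∸n≡0 s≤τ =
  trans (+-identityʳ (A + + 0)) (+-identityʳ A)

orbit-end : ∀ A {α τ ℓ} → α ℕ.≤ ℓ → τ ℕ.≤ ℓ → orbit A α τ ℓ ≡ A + + τ - + ℓ
orbit-end A {α} {τ} {ℓ} α≤ℓ τ≤ℓ rewrite ℕ.m≤n⇒m∸n≡0 α≤ℓ = begin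
  A + + 0 - + (ℓ ∸ τ)       ≡⟨ cong (λ d → A + + 0 - d) (sym (trans (ℤ.m-n≡m⊖n ℓ τ) (ℤ.⊖-≥ τ≤ℓ))) ⟩
  A + + 0 - (+ ℓ - + τ)     ≡⟨ regroup A (+ ℓ) (+ τ) ⟩
  A + + τ - + ℓ             ∎
  where
  open ≡-Reasoning
  regroup : ∀ A l t → A + + 0 - (l - t) ≡ A + t - l
  regroup = solve-∀

∸-suc : ∀ {m n} → n ℕ.< m → m ∸ n ≡ suc (m ∸ suc n)
∸-suc n<m = ℕ.+-∸-assoc 1 n<m

orbit-falls : ∀ A {α τ s} → α ℕ.≤ τ → s ℕ.< α ⊎ τ ℕ.≤ s → orbit A α τ (suc s) ≡ orbit A α τ s - + 1
orbit-falls A {α} {τ} {s} α≤τ (inj₁ s<α)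
  rewrite orbit-descending A α (ℕ.≤-trans s<α α≤τ) | orbit-descending A α (ℕ.<⇒≤ (ℕ.<-≤-trans s<α α≤τ))
        | ∸-suc s<α = drop-one A (+ (α ∸ suc s))
  where drop-one : ∀ A e → A + e ≡ A + (+ 1 + e) - + 1
        drop-one = solve-∀
orbit-falls A {α} {τ} {s} α≤τ (inj₂ τ≤s)
  rewrite orbit-ascending A α≤τ (ℕ.m≤n⇒m≤1+n τ≤s) | orbit-ascending A α≤τ τ≤s
        | ℕ.+-∸-assoc 1 τ≤s = drop-one A (+ (s ∸ τ))
  where drop-one : ∀ A d → A - (+ 1 + d) ≡ A - d - + 1
        drop-one = solve-∀

orbit-lower : ∀ A α τ s d → orbit A α τ s - d ≡ orbit (A - d) α τ s
orbit-lower A α τ s d = regroup A (+ (α ∸ s)) (+ (s ∸ τ)) d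
  where regroup : ∀ A a b d → A + a - b - d ≡ A - d + a - b
        regroup = solve-∀

module _ (A : ℤ) {α τ s : ℕ} (α≤τ : α ℕ.≤ τ) where

  orbit-above-base : s ℕ.< α → A < orbit A α τ s
  orbit-above-base s<α rewrite orbit-descending A α (ℕ.<⇒≤ (ℕ.<-≤-trans s<α α≤τ)) =
    i<i+pos A (ℕ.m<n⇒0<n∸m s<α)

  orbit-below-next : ∀ {ℓ} → α ℕ.< ℓ → s ℕ.≤ τ → orbit A α τ s < A + + ℓ
  orbit-below-next α<ℓ s≤τ rewrite orbit-descending A α s≤τ =
    +-monoʳ-< A (+<+ (ℕ.≤-<-trans (ℕ.m∸n≤m α s) α<ℓ))

  orbit-below-base : τ ℕ.< s → orbit A α τ s < A
  orbit-below-base τ<s rewrite orbit-ascending A α≤τ (ℕ.<⇒≤ τ<s) = i-pos<i A (ℕ.m<n⇒0<n∸m τ<s)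

  orbit-above-prev : ∀ {ℓ} → s ℕ.< ℓ → τ ℕ.≤ s → A - + ℓ < orbit A α τ s
  orbit-above-prev s<ℓ τ≤s rewrite orbit-ascending A α≤τ τ≤s =
    +-monoʳ-< A (ℤ.neg-mono-< (+<+ (ℕ.≤-<-trans (ℕ.m∸n≤m s τ) s<ℓ)))

orbit-≥ : ∀ A α τ s → A - + s ≤ orbit A α τ s
orbit-≥ A α τ s = ℤ.≤-trans (+-monoʳ-≤ A (ℤ.neg-mono-≤ (+≤+ (ℕ.m∸n≤m s τ))))
                            (ℤ.+-monoˡ-≤ (ℤ.- + (s ∸ τ)) (ℤ.i≤i+j A (+ (α ∸ s))))

-- The rest ends at τ = ℓ - (A - p), after which ℓ - τ more falls bring A down to p.
rest-time : ∀ {ℓ A α x p} → x ≡ + α + A → x - + ℓ ≤ p → p ≤ A →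
            Σ ℕ λ τ → α ℕ.≤ τ × τ ℕ.≤ ℓ × A + + τ - + ℓ ≡ p
rest-time {ℓ} {A} {α} {x} {p} refl low high with ≤-witness low | ≤-witness high
... | e , p≡ | d , A≡ = α ℕ.+ e , ℕ.m≤m+n α e , subst (α ℕ.+ e ℕ.≤_) (sym ℓ≡) (ℕ.m≤m+n _ d) , lands
  where
  open ≡-Reasoning
  ℓ≡ : ℓ ≡ α ℕ.+ e ℕ.+ d
  ℓ≡ = +-injective (begin
    + ℓ                                    ≡⟨ isolate (+ α + A) (+ ℓ) (+ e) ⟩
    (+ α + A) - (+ α + A - + ℓ + + e) + + e ≡⟨ cong (λ q → (+ α + A) - q + + e) (sym p≡) ⟩
    (+ α + A) - p + + e                    ≡⟨ cong (λ a → (+ α + a) - p + + e) A≡ ⟩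
    (+ α + (p + + d)) - p + + e            ≡⟨ tidy (+ α) p (+ d) (+ e) ⟩
    + α + + e + + d                        ∎)
    where
    isolate : ∀ x l e → l ≡ x - (x - l + e) + e
    isolate = solve-∀
    tidy : ∀ a p d e → (a + (p + d)) - p + e ≡ a + e + d
    tidy = solve-∀
  lands : A + + (α ℕ.+ e) - + ℓ ≡ p
  lands = begin
    A + + (α ℕ.+ e) - + ℓ                      ≡⟨ cong₂ (λ a l → a + + (α ℕ.+ e) - + l) A≡ ℓ≡ ⟩
    p + + d + (+ α + + e) - (+ α + + e + + d)  ≡⟨ cancel p (+ d) (+ α + + e) ⟩
    p                                          ∎
    where
    cancel : ∀ p d t → p + d + t - (t + d) ≡ p
    cancel = solve-∀

-- How the orbit (A', α') of the predecessor starts relative to the orbit (A, τ) of i: either one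
-- level lower, with its first fall starting when i stops resting, or at the same level, in which
-- case i rests until the end of the period.
data Linked (ℓ : ℕ) (A : ℤ) : ℕ → ℤ → ℕ → Set where
  behind : ∀ {τ} → Linked ℓ A τ (A - + ℓ) τ
  level  : Linked ℓ A ℓ A 0

level-of : ∀ {ℓ A A' τ α'} → A' ≡ A → τ ≡ ℓ → α' ≡ 0 → Linked ℓ A τ A' α'
level-of refl refl refl = level

behind-of : ∀ {ℓ A A' τ α'} → A' ≡ A - + ℓ → τ ≡ α' → Linked ℓ A τ A' α'
behind-of refl refl = behind

linked : ∀ {L A A' τ α'} → + suc L ∣ A → + suc L ∣ A' → α' ℕ.< suc L → τ ℕ.≤ suc L →
         A + + τ - + suc L ≡ A' + + α' → Linked (suc L) A τ A' α'
linked {L} {A} {A'} {τ} {α'} (divides q refl) (divides q' refl) α'<ℓ τ≤ℓ eq = from-gap (q - q') refl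
  where
  -- A - A' = α' + ℓ - τ lies in [0, 2ℓ) and is a multiple of ℓ.
  ℓ = suc L
  D = α' ℕ.+ ℓ ∸ τ
  τ≤α'+ℓ : τ ℕ.≤ α' ℕ.+ ℓ
  τ≤α'+ℓ = ℕ.≤-trans τ≤ℓ (ℕ.m≤n+m ℓ α')
  D+τ : D ℕ.+ τ ≡ α' ℕ.+ ℓ
  D+τ = ℕ.m∸n+n≡m τ≤α'+ℓ
  gap : (q - q') * + ℓ ≡ + D
  gap = begin
    (q - q') * + ℓ                           ≡⟨ rearrange q q' (+ ℓ) (+ τ) ⟩
    (q * + ℓ + + τ - + ℓ) - q' * + ℓ + + ℓ - + τ ≡⟨ cong (λ z → z - q' * + ℓ + + ℓ - + τ) eq ⟩
    (q' * + ℓ + + α') - q' * + ℓ + + ℓ - + τ ≡⟨ cancel q' (+ ℓ) (+ α') (+ τ) ⟩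
    + α' + + ℓ - + τ                         ≡⟨ ℤ.m-n≡m⊖n (α' ℕ.+ ℓ) τ ⟩
    (α' ℕ.+ ℓ) ℤ.⊖ τ                         ≡⟨ ℤ.⊖-≥ τ≤α'+ℓ ⟩
    + D                                      ∎
    where
    open ≡-Reasoning
    rearrange : ∀ q q' l t → (q - q') * l ≡ (q * l + t - l) - q' * l + l - t
    rearrange = solve-∀
    cancel : ∀ q' l a t → (q' * l + a) - q' * l + l - t ≡ a + l - t
    cancel = solve-∀
  quotient-gap : ∀ {d} → q - q' ≡ + d → d ℕ.* ℓ ≡ D
  quotient-gap {d} e = +-injective (trans (ℤ.pos-* d ℓ) (trans (cong (_* + ℓ) (sym e)) gap))
  from-gap : ∀ d → q - q' ≡ d → Linked ℓ (q * + ℓ) τ (q' * + ℓ) α'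
  from-gap (+ 0) q-q'≡0 = level-of (sym (cong (_* + ℓ) (ℤ.i-j≡0⇒i≡j q q' q-q'≡0))) τ≡ℓ α'≡0
    where
    D≡0 : D ≡ 0
    D≡0 = sym (quotient-gap q-q'≡0)
    τ≡α'+ℓ : τ ≡ α' ℕ.+ ℓ
    τ≡α'+ℓ = trans (sym (cong (ℕ._+ τ) D≡0)) D+τ
    α'≡0 : α' ≡ 0
    α'≡0 = ℕ.n≤0⇒n≡0 (ℕ.+-cancelʳ-≤ ℓ α' 0 (subst (ℕ._≤ ℓ) τ≡α'+ℓ τ≤ℓ))
    τ≡ℓ : τ ≡ ℓ
    τ≡ℓ = trans τ≡α'+ℓ (cong (ℕ._+ ℓ) α'≡0)
  from-gap (+ 1) q-q'≡1 = behind-of (one-level-down q q' (+ ℓ) q-q'≡1) τ≡α'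
    where
    one-level-down : ∀ q q' l → q - q' ≡ + 1 → q' * l ≡ q * l - l
    one-level-down q q' l e = begin
      q' * l                 ≡⟨ solve (q ∷ q' ∷ l ∷ []) ⟩
      q * l - (q - q') * l   ≡⟨ cong (λ d → q * l - d * l) e ⟩
      q * l - + 1 * l        ≡⟨ solve (q ∷ l ∷ []) ⟩
      q * l - l              ∎
      where open ≡-Reasoning
    τ≡α' : τ ≡ α'
    τ≡α' = ℕ.+-cancelˡ-≡ ℓ τ α'
             (trans (cong (ℕ._+ τ) (trans (sym (ℕ.*-identityˡ ℓ)) (quotient-gap q-q'≡1))) (trans D+τ (ℕ.+-comm α' ℓ)))
  from-gap (+ suc (suc m)) q-q'≡d = ⊥-elim (ℕ.<-irrefl refl too-big)
    where
    too-big : D ℕ.< D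
    too-big = ℕ.≤-<-trans (ℕ.m∸n≤m (α' ℕ.+ ℓ) τ) (ℕ.<-≤-trans (ℕ.+-monoˡ-< ℓ α'<ℓ)
                (subst (ℓ ℕ.+ ℓ ℕ.≤_) (quotient-gap q-q'≡d) (ℕ.+-monoʳ-≤ ℓ (ℕ.m≤m+n ℓ (m ℕ.* ℓ)))))
  from-gap -[1+ m ] q-q'≡d with trans (sym (cong (_* + ℓ) q-q'≡d)) gap
  ... | ()

orbit-step : ∀ {ℓ A α τ A' α' τ' s} → + ℓ ∣ A → α ℕ.< ℓ → α ℕ.≤ τ → α' ℕ.≤ τ' → s ℕ.< ℓ →
             Linked ℓ A τ A' α' →
             localMove ℓ (orbit A α τ s) (orbit A' α' τ' s) ≡ orbit A α τ (suc s)
orbit-step {ℓ} {A} {α} {τ} {A'} {α'} {τ'} {s} ℓ∣A α<ℓ α≤τ α'≤τ' s<ℓ link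
  with s ℕ.<? α | ℕ.<-cmp s τ
... | yes s<α | _ =
  trans (localMove-falls (inj₁ λ ℓ∣u → no-multiple-above ℓ∣A ℓ∣u (orbit-above-base A α≤τ s<α)
                                          (orbit-below-next A α≤τ α<ℓ (ℕ.<⇒≤ (ℕ.<-≤-trans s<α α≤τ)))))
        (sym (orbit-falls A α≤τ (inj₁ s<α)))
... | no s≮α | tri< s<τ _ _ = trans (cong (λ u → localMove ℓ u _) at-rest)
                                    (trans (localMove-stays ℓ∣A (predecessor-close link)) (sym rests))
  where
  at-rest : orbit A α τ s ≡ A
  at-rest = orbit-at-rest A (ℕ.≮⇒≥ s≮α) (ℕ.<⇒≤ s<τ)
  rests : orbit A α τ (suc s) ≡ A
  rests = orbit-at-rest A (ℕ.m≤n⇒m≤1+n (ℕ.≮⇒≥ s≮α)) s<τ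
  predecessor-close : Linked ℓ A τ A' α' → A - + ℓ < orbit A' α' τ' s
  predecessor-close behind = orbit-above-base (A - + ℓ) α'≤τ' s<τ
  predecessor-close level  = <-≤-trans (+-monoʳ-< A (ℤ.neg-mono-< (+<+ s<ℓ))) (orbit-≥ A 0 τ' s)
... | no s≮α | tri≈ _ refl _ = hand-over link
  where
  hand-over : Linked ℓ A s A' α' →
              localMove ℓ (orbit A α s s) (orbit A' α' τ' s) ≡ orbit A α s (suc s)
  hand-over behind = trans (cong₂ (localMove ℓ) at-rest predecessor-at-rest)
                           (trans (localMove-falls {ℓ} {A} (inj₂ ℤ.≤-refl)) (sym falls))
    where
    at-rest : orbit A α s s ≡ A
    at-rest = orbit-at-rest A α≤τ ℕ.≤-refl
    predecessor-at-rest : orbit (A - + ℓ) s τ' s ≡ A - + ℓ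
    predecessor-at-rest = orbit-at-rest (A - + ℓ) ℕ.≤-refl α'≤τ'
    falls : orbit A α s (suc s) ≡ A - + 1
    falls = trans (orbit-falls A α≤τ (inj₂ ℕ.≤-refl)) (cong (_- + 1) at-rest)
  hand-over level  = ⊥-elim (ℕ.<-irrefl refl s<ℓ)
... | no s≮α | tri> _ _ τ<s =
  trans (localMove-falls (inj₁ λ ℓ∣u → no-multiple-below ℓ∣A ℓ∣u
                                          (orbit-above-prev A α≤τ s<ℓ (ℕ.<⇒≤ τ<s)) (orbit-below-base A α≤τ τ<s)))
        (sym (orbit-falls A α≤τ (inj₂ (ℕ.<⇒≤ τ<s))))

-- Bears, ties and sortedness

precedes⁻ : ∀ {n} (x : Fin n → ℤ) j i → T (precedes x j i) → x j < x i ⊎ (x j ≡ x i × toℕ i ℕ.< toℕ j)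
precedes⁻ x j i t with Equivalence.to (T-∨ {does (x j ℤ.<? x i)}) t
... | inj₁ xj<xi = inj₁ (fromDoes (x j ℤ.<? x i) xj<xi)
... | inj₂ tie   = let (xj≡xi , i<j) = Equivalence.to (T-∧ {does (x j ℤ.≟ x i)}) tie
                   in inj₂ (fromDoes (x j ℤ.≟ x i) xj≡xi , fromDoes (toℕ i ℕ.<? toℕ j) i<j)

precedes⁺ : ∀ {n} (x : Fin n → ℤ) j i → x j < x i ⊎ (x j ≡ x i × toℕ i ℕ.< toℕ j) → T (precedes x j i)
precedes⁺ x j i (inj₁ xj<xi)         = Equivalence.from T-∨ (inj₁ (toDoes (x j ℤ.<? x i) xj<xi))
precedes⁺ x j i (inj₂ (xj≡xi , i<j)) =
  Equivalence.from (T-∨ {does (x j ℤ.<? x i)})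
    (inj₂ (Equivalence.from T-∧ (toDoes (x j ℤ.≟ x i) xj≡xi , toDoes (toℕ i ℕ.<? toℕ j) i<j)))

Sorted : ∀ {n} → (Fin n → ℤ) → Set
Sorted x = ∀ i j → i Fin.≤ j → x i ≤ x j

precedingMultiples : ∀ {n} → ℕ → (Fin n → ℤ) → Fin n → Fin n → Bool
precedingMultiples ℓ x i j = inM ℓ (x j) ∧ precedes x j i

laterNonMultiples : ∀ {n} → ℕ → (Fin n → ℤ) → Fin n → Fin n → Bool
laterNonMultiples ℓ x i j = not (inM ℓ (x j)) ∧ does (toℕ i ℕ.<? toℕ j)

precedingMultiple⁻ : ∀ {n} ℓ (x : Fin n → ℤ) i j → T (precedingMultiples ℓ x i j) →
                     + ℓ ∣ x j × (x j < x i ⊎ (x j ≡ x i × toℕ i ℕ.< toℕ j))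
precedingMultiple⁻ ℓ x i j t = let (ℓ∣xj , j≺i) = Equivalence.to (T-∧ {inM ℓ (x j)}) t
                               in inM-sound (x j) ℓ∣xj , precedes⁻ x j i j≺i

precedingMultiple⁺ : ∀ {n} ℓ (x : Fin n → ℤ) i j → + ℓ ∣ x j → x j < x i ⊎ (x j ≡ x i × toℕ i ℕ.< toℕ j) →
                     T (precedingMultiples ℓ x i j)
precedingMultiple⁺ ℓ x i j ℓ∣xj j≺i =
  Equivalence.from T-∧ (subst T (sym (inM-true ℓ∣xj)) _ , precedes⁺ x j i j≺i)

module _ {n} (k ℓ : ℕ) (x : Fin n → ℤ) where

  isBear-many : n ∸ k ℕ.≤ m ℓ x → ∀ i →
                isBear k ℓ x i ≡ inM ℓ (x i) ∧ does (count (precedingMultiples ℓ x i) ℕ.<? (n ∸ k))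
  isBear-many many i rewrite dec-true ((n ∸ k) ℕ.≤? m ℓ x) many = refl

  isBear-few : ¬ (n ∸ k ℕ.≤ m ℓ x) → ∀ i →
               isBear k ℓ x i ≡ inM ℓ (x i) ∨ does (count (laterNonMultiples ℓ x i) ℕ.<? (n ∸ k ∸ m ℓ x))
  isBear-few few i rewrite dec-false ((n ∸ k) ℕ.≤? m ℓ x) few = refl

  isBear-tie : ∀ {i j} → x i ≡ x j → toℕ i ℕ.≤ toℕ j → T (isBear k ℓ x i) → T (isBear k ℓ x j)
  isBear-tie {i} {j} xi≡xj i≤j bear-i with (n ∸ k) ℕ.≤? m ℓ x
  ... | yes many = subst T (sym (isBear-many many j))
    (T-∧-map (subst (T ∘ inM ℓ) xi≡xj) (count<-antimono (n ∸ k) before-j⇒before-i)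
             (subst T (isBear-many many i) bear-i))
    where
    before-j⇒before-i : ∀ t → T (precedingMultiples ℓ x j t) → T (precedingMultiples ℓ x i t)
    before-j⇒before-i t t≺j with precedingMultiple⁻ ℓ x j t t≺j
    ... | ℓ∣xt , inj₁ xt<xj         =
      precedingMultiple⁺ ℓ x i t ℓ∣xt (inj₁ (subst (x t <_) (sym xi≡xj) xt<xj))
    ... | ℓ∣xt , inj₂ (xt≡xj , j<t) =
      precedingMultiple⁺ ℓ x i t ℓ∣xt (inj₂ (trans xt≡xj (sym xi≡xj) , ℕ.≤-<-trans i≤j j<t))
  ... | no few = subst T (sym (isBear-few few j))
    (T-∨-map (subst (T ∘ inM ℓ) xi≡xj) (count<-antimono (n ∸ k ∸ m ℓ x) after-j⇒after-i)
             (subst T (isBear-few few i) bear-i))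
    where
    after-j⇒after-i : ∀ t → T (laterNonMultiples ℓ x j t) → T (laterNonMultiples ℓ x i t)
    after-j⇒after-i t = T-∧-map id λ j<t →
      toDoes (toℕ i ℕ.<? toℕ t) (ℕ.≤-<-trans i≤j (fromDoes (toℕ j ℕ.<? toℕ t) j<t))

  gmMove-≤ : ∀ i → gmMove k ℓ x i ≤ x i
  gmMove-≤ i with isBear k ℓ x i
  ... | true  = ℤ.≤-refl
  ... | false = ℤ.i-j≤i (x i) (+ 1)

  gmMove-sorted : Sorted x → Sorted (gmMove k ℓ x)
  gmMove-sorted sorted i j i≤j with x i ℤ.<? x j
  ... | yes xi<xj = ≤-trans (gmMove-≤ i) (≤-trans (<⇒≤-1 xi<xj) (below j))
    where
    below : ∀ j → x j - + 1 ≤ gmMove k ℓ x j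
    below j with isBear k ℓ x j
    ... | true  = ℤ.i-j≤i (x j) (+ 1)
    ... | false = ℤ.≤-refl
  ... | no  xi≮xj with isBear k ℓ x j in bear-j
  ...   | true  = ≤-trans (gmMove-≤ i) (sorted i j i≤j)
  ...   | false with isBear k ℓ x i in bear-i
  ...     | false = +-monoˡ-≤ (ℤ.- + 1) (sorted i j i≤j)
  ...     | true  = ⊥-elim (subst T bear-j (isBear-tie xi≡xj i≤j (subst T (sym bear-i) _)))
    where xi≡xj = ℤ.≤-antisym (sorted i j i≤j) (ℤ.≮⇒≥ xi≮xj)

  isBear⇔fixed : ∀ i → (isBear k ℓ x i ≡ true) ⇔ (gmMove k ℓ x i ≡ x i)
  isBear⇔fixed i = mk⇔ (λ bear → cong (λ b → if b then x i else x i - + 1) bear) fixed⇒bear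
    where
    fixed⇒bear : gmMove k ℓ x i ≡ x i → isBear k ℓ x i ≡ true
    fixed⇒bear fixed with isBear k ℓ x i
    ... | true  = refl
    ... | false = ⊥-elim (<-irrefl fixed (i-pos<i (x i) (s≤s z≤n)))

gmSeq-sorted : ∀ {n} k ℓ {x0 : Fin n → ℤ} → Sorted x0 → ∀ t → Sorted (gmSeq k ℓ x0 t)
gmSeq-sorted k ℓ sorted zero    = sorted
gmSeq-sorted k ℓ sorted (suc t) = gmMove-sorted k ℓ _ (gmSeq-sorted k ℓ sorted t)

-- The stable regime

module StableRegime (n' k L : ℕ) (k<n : k ℕ.< suc n') where

  n ℓ : ℕ
  n = suc n'
  ℓ = suc L

  record Stable (x : Fin n → ℤ) : Set where
    field
      sorted         : Sorted x
      narrow         : range x ≤ + ℓ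
      many-multiples : n ∸ k ℕ.≤ m ℓ x

    spread : ∀ i j → x j ≤ x i + + ℓ
    spread i j = ≤-trans (sorted j last (subst (toℕ j ℕ.≤_) (sym (Fin.toℕ-fromℕ n')) (Fin.toℕ≤pred[n] j)))
                         (≤-trans (≤-translate (x zero) (-+-cancel _ _) (ℤ.+-comm (+ ℓ) (x zero)) narrow)
                                  (+-monoˡ-≤ (+ ℓ) (sorted zero i z≤n)))
      where last = Fin.fromℕ n'

  -- predIdx i is i - k mod n, and lapDrop i is ℓ exactly when that subtraction wraps around.
  predIdx : Fin n → Fin n
  predIdx i with k ℕ.≤? toℕ i
  ... | yes _   = Fin.fromℕ< (ℕ.≤-<-trans (ℕ.m∸n≤m (toℕ i) k) (Fin.toℕ<n i))
  ... | no  i≱k = Fin.fromℕ< (subst (toℕ i ℕ.+ (n ∸ k) ℕ.<_) (ℕ.m+[n∸m]≡n (ℕ.<⇒≤ k<n))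
                                    (ℕ.+-monoˡ-< (n ∸ k) (ℕ.≰⇒> i≱k)))

  lapDrop : Fin n → ℤ
  lapDrop i with k ℕ.≤? toℕ i
  ... | yes _ = + 0
  ... | no  _ = + ℓ

  pre : (Fin n → ℤ) → Fin n → ℤ
  pre x i = x (predIdx i) - lapDrop i

  data Predecessor (i s : Fin n) (δ : ℤ) : Set where
    same-lap : toℕ s ℕ.+ k ≡ toℕ i → δ ≡ + 0 → Predecessor i s δ
    prev-lap : toℕ i ℕ.+ (n ∸ k) ≡ toℕ s → δ ≡ + ℓ → Predecessor i s δ

  predecessor : ∀ i → Predecessor i (predIdx i) (lapDrop i)
  predecessor i with k ℕ.≤? toℕ i
  ... | yes k≤i = same-lap (trans (cong (ℕ._+ k) (Fin.toℕ-fromℕ< _)) (ℕ.m∸n+n≡m k≤i)) refl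
  ... | no  _   = prev-lap (sym (Fin.toℕ-fromℕ< _)) refl

  pre-same-lap : ∀ x {i} → lapDrop i ≡ + 0 → pre x i ≡ x (predIdx i)
  pre-same-lap x {i} δ≡0 = trans (cong (x (predIdx i) -_) δ≡0) (+-identityʳ _)

  pre-prev-lap : ∀ x {i} → lapDrop i ≡ + ℓ → pre x i ≡ x (predIdx i) - + ℓ
  pre-prev-lap x {i} δ≡ℓ = cong (x (predIdx i) -_) δ≡ℓ

  module _ {x : Fin n → ℤ} (st : Stable x) (i : Fin n) (ℓ∣xi : + ℓ ∣ x i) where
    open Stable st

    -- A multiple precedes x i only if it is at most x i - ℓ or ties with x i to the right of i.
    -- Comparing with the values from predIdx i to i (cyclically) shows that fewer than n - k
    -- indices precede i when pre x i > x i - ℓ, and at least n - k when pre x i ≤ x i - ℓ.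
    few-precede : x i - + ℓ < pre x i → count (precedingMultiples ℓ x i) ℕ.< n ∸ k
    few-precede close with predecessor i
    ... | same-lap s+k≡i δ≡0 = few-outside-window k<n _ s+k≡i (Fin.toℕ<n i) excluded
      where
      s = predIdx i
      xi-ℓ<xs : x i - + ℓ < x s
      xi-ℓ<xs = subst (_ <_) (pre-same-lap x δ≡0) close
      excluded : ∀ j → T (precedingMultiples ℓ x i j) → toℕ s ℕ.≤ toℕ j → toℕ j ℕ.≤ toℕ i → ⊥
      excluded j t s≤j j≤i with precedingMultiple⁻ ℓ x i j t
      ... | ℓ∣xj , inj₁ xj<xi     = no-multiple-below ℓ∣xi ℓ∣xj (<-≤-trans xi-ℓ<xs (sorted s j s≤j)) xj<xi
      ... | _    , inj₂ (_ , i<j) = ℕ.<⇒≱ i<j j≤i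
    ... | prev-lap i+n-k≡s δ≡ℓ = few-inside-window k<n _ i+n-k≡s (Fin.toℕ<n s) confined
      where
      s = predIdx i
      xi-ℓ<xs-ℓ : x i - + ℓ < x s - + ℓ
      xi-ℓ<xs-ℓ = subst (_ <_) (pre-prev-lap x δ≡ℓ) close
      confined : ∀ j → T (precedingMultiples ℓ x i j) → toℕ i ℕ.< toℕ j × toℕ j ℕ.< toℕ s
      confined j t with precedingMultiple⁻ ℓ x i j t
      ... | ℓ∣xj , inj₁ xj<xi =
        ⊥-elim (no-multiple-below ℓ∣xi ℓ∣xj (<-≤-trans xi-ℓ<xs-ℓ (≤+⇒-≤ (+ ℓ) (spread j s))) xj<xi)
      ... | _ , inj₂ (xj≡xi , i<j) = i<j , ℕ.≰⇒> λ s≤j →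
        ℤ.<⇒≱ (-‿cancelʳ-< (+ ℓ) xi-ℓ<xs-ℓ) (subst (x s ≤_) xj≡xi (sorted s j s≤j))

    many-precede : pre x i ≤ x i - + ℓ → n ∸ k ℕ.≤ count (precedingMultiples ℓ x i)
    many-precede far with predecessor i
    ... | same-lap s+k≡i δ≡0 = many-outside-window k<n _ s+k≡i (Fin.toℕ<n i) included
      where
      s = predIdx i
      xs≤xi-ℓ : x s ≤ x i - + ℓ
      xs≤xi-ℓ = subst (_≤ _) (pre-same-lap x δ≡0) far
      included : ∀ j → toℕ j ℕ.≤ toℕ s ⊎ toℕ i ℕ.< toℕ j → T (precedingMultiples ℓ x i j)
      included j (inj₁ j≤s) =
        precedingMultiple⁺ ℓ x i j (subst (+ ℓ ∣_) (sym xj≡xi-ℓ) (∣m∣n⇒∣m-n ℓ∣xi ∣-refl))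
                                   (inj₁ (subst (_< x i) (sym xj≡xi-ℓ) (i-pos<i (x i) (s≤s z≤n))))
        where
        xj≡xi-ℓ : x j ≡ x i - + ℓ
        xj≡xi-ℓ = ℤ.≤-antisym (≤-trans (sorted j s j≤s) xs≤xi-ℓ) (≤+⇒-≤ (+ ℓ) (spread j i))
      included j (inj₂ i<j) =
        precedingMultiple⁺ ℓ x i j (subst (+ ℓ ∣_) (sym xj≡xi) ℓ∣xi) (inj₂ (xj≡xi , i<j))
        where
        xj≡xi : x j ≡ x i
        xj≡xi = ℤ.≤-antisym (≤-trans (spread s j) (≤-⇒+≤ (+ ℓ) xs≤xi-ℓ)) (sorted i j (ℕ.<⇒≤ i<j))
    ... | prev-lap i+n-k≡s δ≡ℓ = many-inside-window k<n _ i+n-k≡s (Fin.toℕ<n s) included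
      where
      s = predIdx i
      xs≤xi : x s ≤ x i
      xs≤xi = -‿cancelʳ-≤ (+ ℓ) (subst (_≤ _) (pre-prev-lap x δ≡ℓ) far)
      included : ∀ j → toℕ i ℕ.< toℕ j → toℕ j ℕ.≤ toℕ s → T (precedingMultiples ℓ x i j)
      included j i<j j≤s =
        precedingMultiple⁺ ℓ x i j (subst (+ ℓ ∣_) (sym xj≡xi) ℓ∣xi) (inj₂ (xj≡xi , i<j))
        where
        xj≡xi : x j ≡ x i
        xj≡xi = ℤ.≤-antisym (≤-trans (sorted j s j≤s) xs≤xi) (sorted i j (ℕ.<⇒≤ i<j))

  isBear≡stays : ∀ {x} → Stable x → ∀ i → isBear k ℓ x i ≡ stays ℓ (x i) (pre x i)
  isBear≡stays {x} st i =
    trans (isBear-many k ℓ x (Stable.many-multiples st) i)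
          (∧-cong-T (inM ℓ (x i)) (tests-agree ∘ inM-sound (x i)))
    where
    count-test = count (precedingMultiples ℓ x i) ℕ.<? (n ∸ k)
    tests-agree : + ℓ ∣ x i → does count-test ≡ does (x i - + ℓ ℤ.<? pre x i)
    tests-agree ℓ∣xi with x i - + ℓ ℤ.<? pre x i
    ... | yes close = dec-true count-test (few-precede st i ℓ∣xi close)
    ... | no  far   = dec-false count-test (ℕ.≤⇒≯ (many-precede st i ℓ∣xi (ℤ.≮⇒≥ far)))

  module _ {x : Fin n → ℤ} (st : Stable x) (i : Fin n) where
    open Stable st

    pre-≥ : x i - + ℓ ≤ pre x i
    pre-≥ with predecessor i
    ... | same-lap _ δ≡0 = subst (_ ≤_) (sym (pre-same-lap x δ≡0)) (≤+⇒-≤ (+ ℓ) (spread (predIdx i) i))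
    ... | prev-lap i+n-k≡s δ≡ℓ =
      subst (_ ≤_) (sym (pre-prev-lap x δ≡ℓ))
            (+-monoˡ-≤ (ℤ.- + ℓ) (sorted i (predIdx i) (subst (toℕ i ℕ.≤_) i+n-k≡s (ℕ.m≤m+n _ _))))

    -- Otherwise no multiple of ℓ lies in the cyclic window of k + 1 indices from predIdx i to i,
    -- leaving fewer than n - k of them.
    pre-≤-roundDown : pre x i ≤ roundDown ℓ (x i)
    pre-≤-roundDown with pre x i ℤ.≤? roundDown ℓ (x i)
    ... | yes below = below
    ... | no  above = ⊥-elim (ℕ.<⇒≱ (too-few (ℤ.≰⇒> above)) many-multiples)
      where
      F = roundDown ℓ (x i)
      ℓ∣F = roundDown-multiple ℓ (x i)
      xi<F+ℓ = <-roundDown+ℓ ℓ (x i)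
      too-few : F < pre x i → m ℓ x ℕ.< n ∸ k
      too-few F<pre with predecessor i
      ... | same-lap s+k≡i δ≡0 = few-outside-window k<n _ s+k≡i (Fin.toℕ<n i) λ j t s≤j j≤i →
        no-multiple-above ℓ∣F (inM-sound (x j) t) (<-≤-trans F<xs (sorted s j s≤j))
                              (≤-<-trans (sorted j i j≤i) xi<F+ℓ)
        where
        s = predIdx i
        F<xs : F < x s
        F<xs = subst (F <_) (pre-same-lap x δ≡0) F<pre
      ... | prev-lap i+n-k≡s δ≡ℓ = few-inside-window k<n _ i+n-k≡s (Fin.toℕ<n s) λ j t →
        let ℓ∣xj = inM-sound (x j) t in
        ℕ.≰⇒> (λ j≤i → no-multiple-above ℓ∣F ℓ∣xj (<-≤-trans F<xs-ℓ (≤+⇒-≤ (+ ℓ) (spread j s)))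
                                                  (≤-<-trans (sorted j i j≤i) xi<F+ℓ)) ,
        ℕ.≰⇒> (λ s≤j → no-multiple-above ℓ∣F (∣m∣n⇒∣m-n ℓ∣xj ∣-refl)
                                                  (<-≤-trans F<xs-ℓ (+-monoˡ-≤ (ℤ.- + ℓ) (sorted s j s≤j)))
                                                  (≤-<-trans (≤+⇒-≤ (+ ℓ) (spread i j)) xi<F+ℓ))
        where
        s = predIdx i
        F<xs-ℓ : F < x s - + ℓ
        F<xs-ℓ = subst (F <_) (pre-prev-lap x δ≡ℓ) F<pre

  gmMove-local : ∀ {x} → Stable x → ∀ i → gmMove k ℓ x i ≡ localMove ℓ (x i) (pre x i)
  gmMove-local {x} st i = cong (λ b → if b then x i else x i - + 1) (isBear≡stays st i)

  lapDrop-multiple : ∀ i → + ℓ ∣ lapDrop i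
  lapDrop-multiple i with predecessor i
  ... | same-lap _ δ≡0 = subst (+ ℓ ∣_) (sym δ≡0) (divides (+ 0) refl)
  ... | prev-lap _ δ≡ℓ = subst (+ ℓ ∣_) (sym δ≡ℓ) ∣-refl

  module _ (y : ℕ → Fin n → ℤ) (step : ∀ s → y (suc s) ≡ gmMove k ℓ (y s))
           (stable : ∀ s → s ℕ.< ℓ → Stable (y s)) where

    private
      x = y 0
      A : Fin n → ℤ
      A i = roundDown ℓ (x i)
      α : Fin n → ℕ
      α i = x i %ℕ ℓ
      rest : ∀ i → Σ ℕ λ τ → α i ℕ.≤ τ × τ ℕ.≤ ℓ × A i + + τ - + ℓ ≡ pre x i
      rest i = rest-time (roundDown+residue ℓ (x i)) (pre-≥ (stable 0 (s≤s z≤n)) i)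
                                                     (pre-≤-roundDown (stable 0 (s≤s z≤n)) i)
      restEnd : Fin n → ℕ
      restEnd i = proj₁ (rest i)
      α≤restEnd : ∀ i → α i ℕ.≤ restEnd i
      α≤restEnd i = proj₁ (proj₂ (rest i))
      restEnd≤ℓ : ∀ i → restEnd i ℕ.≤ ℓ
      restEnd≤ℓ i = proj₁ (proj₂ (proj₂ (rest i)))
      lands : ∀ i → A i + + restEnd i - + ℓ ≡ pre x i
      lands i = proj₂ (proj₂ (proj₂ (rest i)))

      link : ∀ i → Linked ℓ (A i) (restEnd i) (A (predIdx i) - lapDrop i) (α (predIdx i))
      link i = linked (roundDown-multiple ℓ (x i)) (∣m∣n⇒∣m-n (roundDown-multiple ℓ (x σ)) (lapDrop-multiple i))
                      (residue<ℓ ℓ (x σ)) (restEnd≤ℓ i) (trans (lands i) split)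
        where
        σ = predIdx i
        split : pre x i ≡ A σ - lapDrop i + + α σ
        split = trans (cong (_- lapDrop i) (roundDown+residue ℓ (x σ))) (regroup (+ α σ) (A σ) (lapDrop i))
          where regroup : ∀ a r d → a + r - d ≡ r - d + a
                regroup = solve-∀

    along-orbit : ∀ s → s ℕ.≤ ℓ → ∀ i → y s i ≡ orbit (A i) (α i) (restEnd i) s
    along-orbit zero _ i = trans (roundDown+residue ℓ (x i)) (sym (orbit-start (A i) (α i) (restEnd i)))
    along-orbit (suc s) s<ℓ i = begin
      y (suc s) i                                 ≡⟨ cong (λ z → z i) (step s) ⟩
      gmMove k ℓ (y s) i                          ≡⟨ gmMove-local (stable s s<ℓ) i ⟩
      localMove ℓ (y s i) (y s σ - lapDrop i)     ≡⟨ cong₂ (λ u v → localMove ℓ u (v - lapDrop i)) (IH i) (IH σ) ⟩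
      localMove ℓ (orbitᵢ s) (orbit (A σ) (α σ) (restEnd σ) s - lapDrop i)
        ≡⟨ cong (localMove ℓ (orbitᵢ s)) (orbit-lower (A σ) (α σ) (restEnd σ) s (lapDrop i)) ⟩
      localMove ℓ (orbitᵢ s) (orbit (A σ - lapDrop i) (α σ) (restEnd σ) s)
        ≡⟨ orbit-step (roundDown-multiple ℓ (x i)) (residue<ℓ ℓ (x i)) (α≤restEnd i) (α≤restEnd σ) s<ℓ (link i) ⟩
      orbitᵢ (suc s)                              ∎
      where
      open ≡-Reasoning
      σ = predIdx i
      orbitᵢ = orbit (A i) (α i) (restEnd i)
      IH = along-orbit s (ℕ.<⇒≤ s<ℓ)

    period : ∀ i → y ℓ i ≡ pre (y 0) i
    period i = trans (along-orbit ℓ ℕ.≤-refl i)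
                     (trans (orbit-end (A i) (ℕ.<⇒≤ (residue<ℓ ℓ (x i))) (restEnd≤ℓ i)) (lands i))

  toℕ-shiftIdx : ∀ i → toℕ (shiftIdx k i) ≡ toℕ i ℕ.+ k ⊎ toℕ (shiftIdx k i) ℕ.+ n ≡ toℕ i ℕ.+ k
  toℕ-shiftIdx i with toℕ i ℕ.+ k ℕ.<? n
  ... | yes i+k<n = inj₁ (trans (Fin.toℕ-fromℕ< _) (m<n⇒m%n≡m i+k<n))
  ... | no  i+k≮n = inj₂ (trans (cong (ℕ._+ n) p≡r) (ℕ.m∸n+n≡m (ℕ.≮⇒≥ i+k≮n)))
    where
    r = toℕ i ℕ.+ k ∸ n
    r<n : r ℕ.< n
    r<n = ℕ.m<n+o⇒m∸n<o (toℕ i ℕ.+ k) n (ℕ.+-mono-< (Fin.toℕ<n i) k<n)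
    p≡r : toℕ (shiftIdx k i) ≡ r
    p≡r = begin
      toℕ (shiftIdx k i)        ≡⟨ Fin.toℕ-fromℕ< _ ⟩
      (toℕ i ℕ.+ k) % n         ≡⟨ cong (_% n) (sym (ℕ.m∸n+n≡m (ℕ.≮⇒≥ i+k≮n))) ⟩
      (r ℕ.+ n) % n             ≡⟨ [m+n]%n≡m%n r n ⟩
      r % n                     ≡⟨ m<n⇒m%n≡m r<n ⟩
      r                         ∎
      where open ≡-Reasoning

  predIdx-shiftIdx : ∀ i → predIdx (shiftIdx k i) ≡ i
  predIdx-shiftIdx i = Fin.toℕ-injective (go (toℕ-shiftIdx i) (predecessor p))
    where
    p = shiftIdx k i
    q = predIdx p
    wrap : toℕ p ℕ.+ (n ∸ k) ≡ toℕ q → toℕ q ℕ.+ k ≡ toℕ p ℕ.+ n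
    wrap p+n-k≡q = trans (cong (ℕ._+ k) (sym p+n-k≡q))
                         (trans (ℕ.+-assoc (toℕ p) (n ∸ k) k) (cong (toℕ p ℕ.+_) (ℕ.m∸n+n≡m (ℕ.<⇒≤ k<n))))
    too-large : ∀ (j : Fin n) a → toℕ j ≡ a ℕ.+ n → ⊥
    too-large j a j≡a+n = ℕ.<⇒≱ (Fin.toℕ<n j) (subst (n ℕ.≤_) (sym j≡a+n) (ℕ.m≤n+m n a))
    go : toℕ p ≡ toℕ i ℕ.+ k ⊎ toℕ p ℕ.+ n ≡ toℕ i ℕ.+ k → Predecessor p q (lapDrop p) → toℕ q ≡ toℕ i
    go (inj₁ p≡i+k)   (same-lap q+k≡p _)   = ℕ.+-cancelʳ-≡ k _ _ (trans q+k≡p p≡i+k)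
    go (inj₂ p+n≡i+k) (prev-lap p+n-k≡q _) = ℕ.+-cancelʳ-≡ k _ _ (trans (wrap p+n-k≡q) p+n≡i+k)
    go (inj₁ p≡i+k)   (prev-lap p+n-k≡q _) = ⊥-elim (too-large q (toℕ i) (ℕ.+-cancelʳ-≡ k _ _ (begin
      toℕ q ℕ.+ k           ≡⟨ wrap p+n-k≡q ⟩
      toℕ p ℕ.+ n           ≡⟨ cong (ℕ._+ n) p≡i+k ⟩
      toℕ i ℕ.+ k ℕ.+ n     ≡⟨ +-right-comm (toℕ i) k n ⟩
      toℕ i ℕ.+ n ℕ.+ k     ∎)))
      where open ≡-Reasoning
    go (inj₂ p+n≡i+k) (same-lap q+k≡p _)   = ⊥-elim (too-large i (toℕ q) (ℕ.+-cancelʳ-≡ k _ _ (begin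
      toℕ i ℕ.+ k           ≡⟨ sym p+n≡i+k ⟩
      toℕ p ℕ.+ n           ≡⟨ cong (ℕ._+ n) (sym q+k≡p) ⟩
      toℕ q ℕ.+ k ℕ.+ n     ≡⟨ +-right-comm (toℕ q) k n ⟩
      toℕ q ℕ.+ n ℕ.+ k     ∎)))
      where open ≡-Reasoning

  gmSeq-shift : ∀ {x0 N} → (∀ t → N ℕ.≤ t → Stable (gmSeq k ℓ x0 t)) → ∀ t → N ℕ.≤ t → ∀ i →
                gmSeq k ℓ x0 (t ℕ.+ ℓ) (shiftIdx k i) ≡ gmSeq k ℓ x0 t i - lapDrop (shiftIdx k i)
  gmSeq-shift {x0} stable t N≤t i = begin
    x (t ℕ.+ ℓ) p               ≡⟨ cong (λ u → x u p) (ℕ.+-comm t ℓ) ⟩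
    x (ℓ ℕ.+ t) p               ≡⟨ period (λ s → x (s ℕ.+ t)) (λ _ → refl)
                                          (λ s _ → stable (s ℕ.+ t) (ℕ.≤-trans N≤t (ℕ.m≤n+m t s))) p ⟩
    x t (predIdx p) - lapDrop p ≡⟨ cong (λ j → x t j - lapDrop p) (predIdx-shiftIdx i) ⟩
    x t i - lapDrop p           ∎
    where
    open ≡-Reasoning
    x = gmSeq k ℓ x0
    p = shiftIdx k i

lemma1 : (n k ℓ : ℕ) → 0 ℕ.< k → k ℕ.< n → 1 ℕ.< ℓ →
         (x0 : Fin n → ℤ) →
         (∀ (i j : Fin n) → i Fin.≤ j → x0 i ℤ.≤ x0 j) →
         (N : ℕ) →
         (∀ (j : ℕ) → ((n ∸ k ℕ.≤ m ℓ (gmSeq k ℓ x0 j)) × (range (gmSeq k ℓ x0 j) ℤ.≤ + ℓ)) ⇔ (N ℕ.≤ j)) →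
         ∀ (i : Fin n) (j : ℕ) → N ℕ.≤ j →
         (isBear k ℓ (gmSeq k ℓ x0 j) i ≡ true) ⇔ (isBear k ℓ (gmSeq k ℓ x0 (j ℕ.+ ℓ)) (shiftIdx k i) ≡ true)
lemma1 zero     k ℓ       _ () _
lemma1 (suc n') k zero    _ _  ()
lemma1 (suc n') k (suc L) _ k<n _ x0 sorted0 N regime i j N≤j =
  ⇔.trans (isBear⇔fixed k ℓ (x j) i)
    (⇔.trans fixed⇔shifted-fixed (⇔.sym (isBear⇔fixed k ℓ (x (j ℕ.+ ℓ)) (shiftIdx k i))))
  where
  open StableRegime n' k L k<n
  x = gmSeq k ℓ x0
  stable : ∀ t → N ℕ.≤ t → Stable (x t)
  stable t N≤t = let (many , narrow) = Equivalence.from (regime t) N≤t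
                 in record { sorted = gmSeq-sorted k ℓ sorted0 t ; narrow = narrow ; many-multiples = many }
  fixed⇔shifted-fixed :
    (x (suc j) i ≡ x j i) ⇔ (x (suc j ℕ.+ ℓ) (shiftIdx k i) ≡ x (j ℕ.+ ℓ) (shiftIdx k i))
  fixed⇔shifted-fixed = subst₂ (λ a b → (x (suc j) i ≡ x j i) ⇔ (a ≡ b))
    (sym (gmSeq-shift stable (suc j) (ℕ.m≤n⇒m≤1+n N≤j) i)) (sym (gmSeq-shift stable j N≤j i)) (-‿cong⇔ _)
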